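{- Let $n > d \ge 1$ be integers and let $A \subseteq \{1,2,\dots,n+1\}$ be a set of integers such that $|i-j| \ge d$ for all distinct $i,j \in A$. Then $$P(n+1,d) \ge \sum_{i \in A} P_d\big(\{1,\dots,n+1\}\setminus\{i\}\big).$$
   Context: For a finite set $\Sigma$ of positive integers, a permutation over $\Sigma$ is a sequence $(\sigma(1),\dots,\sigma(|\Sigma|))$ listing each element of $\Sigma$ exactly once. The Chebyshev distance between two permutations $\sigma,\pi$ over $\Sigma$ is $d(\sigma,\pi)=\max_{i}|\sigma(i)-\pi(i)|$, the maximum over positions $i$. $P_d(\Sigma)$ denotes the maximum cardinality of a set of permutations over $\Sigma$ in which any two distinct permutations have Chebyshev distance at least $d$. $P(n,d)=P_d(\{1,\dots,n\})$. -}

module Defs where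

open import Data.Nat using (ℕ; zero; suc; _≤_; _⊔_; ∣_-_∣; _≟_)
open import Data.List using (List; []; _∷_; map; upTo; filter; length; zipWith; foldr)
open import Data.List.Relation.Unary.All using (All)
open import Data.List.Relation.Unary.Unique.Propositional using (Unique)
open import Data.List.Relation.Unary.AllPairs using (AllPairs)
open import Data.List.Relation.Binary.Permutation.Propositional using (_↭_)
open import Data.Product using (_×_; Σ; ∃-syntax)
open import Relation.Binary.PropositionalEquality using (_≡_; _≢_)
open import Relation.Nullary.Decidable using (¬?)

-- A finite set Σ of positive integers is represented by a duplicate-free list
-- of its elements (order irrelevant).

IsPermOver : List ℕ → List ℕ → Set
IsPermOver Σ σ = σ ↭ Σ

cheb : List ℕ → List ℕ → ℕ
cheb σ π = foldr _⊔_ 0 (zipWith ∣_-_∣ σ π)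

IsCode : ℕ → List ℕ → List (List ℕ) → Set
IsCode d Σ C =
  All (IsPermOver Σ) C × AllPairs (λ σ π → σ ≢ π × d ≤ cheb σ π) C

IsPd : ℕ → List ℕ → ℕ → Set
IsPd d Σ m =
  (∃[ C ] (IsCode d Σ C × length C ≡ m)) ×
  (∀ C → IsCode d Σ C → length C ≤ m)

range : ℕ → List ℕ
range n = map suc (upTo n)

rangeWithout : ℕ → ℕ → List ℕ
rangeWithout n i = filter (λ j → ¬? (j ≟ i)) (range n)

{-# OPTIONS --safe #-}
module Submission where

-- Fix for every i ∈ A an optimal code on Σ ∖ {i} and prepend i to each of its
-- words: this gives permutations of Σ, and prepending a common symbol keeps the
-- distances inside one code. Words stemming from different i, j ∈ A already
-- differ by |i - j| ≥ d in the first position, so the union of all these codes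
-- is a code on Σ of size Σ_{i ∈ A} P_d(Σ ∖ {i}).

open import Defs
open import Data.Nat using (ℕ; suc; _≤_; _<_; ∣_-_∣; _≟_; _+_)
open import Data.Nat.Properties using (m≤n⇒m≤o⊔n; m≤n⇒m≤n⊔o; ≤-reflexive; ≤-trans)
open import Data.Nat.ListAction using (sum)
open import Data.List using (List; []; _∷_; map; _++_; length; filter)
open import Data.List.Properties using (filter-all; filter-accept; filter-reject; length-++; length-map)
open import Data.List.Membership.Propositional using (_∈_)
open import Data.List.Relation.Unary.Any using (here; there)
open import Data.List.Relation.Unary.All as All using (All; []; _∷_)
import Data.List.Relation.Unary.All.Properties as All
open import Data.List.Relation.Unary.AllPairs as AllPairs using (AllPairs; []; _∷_)
import Data.List.Relation.Unary.AllPairs.Properties as AllPairs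
open import Data.List.Relation.Unary.Unique.Propositional using (Unique)
import Data.List.Relation.Unary.Unique.Propositional.Properties as Unique
open import Data.List.Relation.Binary.Permutation.Propositional using (_↭_; prep; swap; ↭-trans; ↭-refl)
open import Data.Product using (_×_; _,_; proj₁; ∃-syntax)
open import Relation.Binary.PropositionalEquality using (_≡_; _≢_; refl; sym; cong₂; module ≡-Reasoning)
open import Relation.Nullary.Decidable using (¬?)

without : ℕ → List ℕ → List ℕ
without i = filter (λ j → ¬? (j ≟ i))

∷-without-↭ : ∀ {i xs} → Unique xs → i ∈ xs → (i ∷ without i xs) ↭ xs
∷-without-↭ {i} {i ∷ xs} (i∉xs ∷ _) (here refl)
  rewrite filter-reject (λ j → ¬? (j ≟ i)) {xs = xs} (λ i≢i → i≢i refl)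
        | filter-all (λ j → ¬? (j ≟ i)) {xs = xs} (All.map (λ i≢j j≡i → i≢j (sym j≡i)) i∉xs)
  = ↭-refl
∷-without-↭ {i} {x ∷ xs} (x∉xs ∷ xs-unique) (there i∈xs)
  rewrite filter-accept (λ j → ¬? (j ≟ i)) {x = x} {xs = xs} (All.lookup x∉xs i∈xs)
  = ↭-trans (swap i x ↭-refl) (prep x (∷-without-↭ xs-unique i∈xs))

Unique-range : ∀ n → Unique (range n)
Unique-range n = Unique.map⁺ (λ { refl → refl }) (Unique.upTo⁺ n)

Separated : ℕ → List ℕ → List ℕ → Set
Separated d σ π = σ ≢ π × d ≤ cheb σ π

separated-∷ : ∀ {d i σ π} → Separated d σ π → Separated d (i ∷ σ) (i ∷ π)
separated-∷ {i = i} (σ≢π , d≤cheb) = (λ { refl → σ≢π refl }) , m≤n⇒m≤o⊔n ∣ i - i ∣ d≤cheb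

separated-heads : ∀ {d i j σ π} → i ≢ j → d ≤ ∣ i - j ∣ → Separated d (i ∷ σ) (j ∷ π)
separated-heads i≢j d≤∣i-j∣ = (λ { refl → i≢j refl }) , m≤n⇒m≤n⊔o _ d≤∣i-j∣

IsCode-map-∷ : ∀ {d i Σ Σ′ C} → (i ∷ Σ) ↭ Σ′ → IsCode d Σ C → IsCode d Σ′ (map (i ∷_) C)
IsCode-map-∷ {i = i} i∷Σ↭Σ′ (perms , separated) =
  All.map⁺ (All.map (λ σ↭Σ → ↭-trans (prep i σ↭Σ) i∷Σ↭Σ′) perms) ,
  AllPairs.map⁺ (AllPairs.map separated-∷ separated)

IsCode-++ : ∀ {d Σ C D} → IsCode d Σ C → IsCode d Σ D →
            All (λ σ → All (Separated d σ) D) C → IsCode d Σ (C ++ D)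
IsCode-++ (permsC , separatedC) (permsD , separatedD) across =
  All.++⁺ permsC permsD , AllPairs.++⁺ separatedC separatedD across

HeadIn : List ℕ → List ℕ → Set
HeadIn A σ = ∃[ j ] j ∈ A × ∃[ τ ] σ ≡ j ∷ τ

separated-from-heads : ∀ {d i A σ C} → All (i ≢_) A → All (λ j → d ≤ ∣ i - j ∣) A →
                       All (HeadIn A) C → All (Separated d (i ∷ σ)) C
separated-from-heads i∉A far = All.map λ { (j , j∈A , τ , refl) →
  separated-heads (All.lookup i∉A j∈A) (All.lookup far j∈A) }

code-from-separated-deletions :
  ∀ {d Σ} A → Unique Σ → Unique A → All (_∈ Σ) A →
  AllPairs (λ i j → d ≤ ∣ i - j ∣) A → (Pw : ℕ → ℕ) →
  All (λ i → ∃[ C ] IsCode d (without i Σ) C × length C ≡ Pw i) A →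
  ∃[ C ] IsCode d Σ C × length C ≡ sum (map Pw A) × All (HeadIn A) C
code-from-separated-deletions [] _ _ _ _ _ _ = [] , ([] , []) , refl , []
code-from-separated-deletions {d} {Σ} (i ∷ A) Σ-unique (i∉A ∷ A-unique) (i∈Σ ∷ A⊆Σ)
  (far ∷ separatedA) Pw ((Cᵢ , Cᵢ-code , |Cᵢ|) ∷ codes)
  with code-from-separated-deletions A Σ-unique A-unique A⊆Σ separatedA Pw codes
... | C , C-code , |C| , heads =
  map (i ∷_) Cᵢ ++ C ,
  IsCode-++ (IsCode-map-∷ (∷-without-↭ Σ-unique i∈Σ) Cᵢ-code) C-code
    (All.map⁺ (All.tabulate λ _ → separated-from-heads i∉A far heads)) ,
  length-sum ,
  All.++⁺ (All.map⁺ (All.tabulate λ {σ} _ → i , here refl , σ , refl))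
          (All.map (λ { (j , j∈A , τ , σ≡j∷τ) → j , there j∈A , τ , σ≡j∷τ }) heads)
  where
  open ≡-Reasoning
  length-sum : length (map (i ∷_) Cᵢ ++ C) ≡ Pw i + sum (map Pw A)
  length-sum = begin
    length (map (i ∷_) Cᵢ ++ C)       ≡⟨ length-++ (map (i ∷_) Cᵢ) ⟩
    length (map (i ∷_) Cᵢ) + length C ≡⟨ cong₂ _+_ (length-map (i ∷_) Cᵢ) refl ⟩
    length Cᵢ + length C              ≡⟨ cong₂ _+_ |Cᵢ| |C| ⟩
    Pw i + sum (map Pw A)             ∎

theorem2 : (n d : ℕ) → 1 ≤ d → d < n →
    (A : List ℕ) → Unique A → All (λ i → i ∈ range (suc n)) A →
    AllPairs (λ i j → d ≤ ∣ i - j ∣) A →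
    (Pn+1 : ℕ) → IsPd d (range (suc n)) Pn+1 →
    (Pw : ℕ → ℕ) → All (λ i → IsPd d (rangeWithout (suc n) i) (Pw i)) A →
    sum (map Pw A) ≤ Pn+1
theorem2 n d _ _ A A-unique A⊆range separatedA Pn+1 (_ , maximal) Pw optimal
  with code-from-separated-deletions A (Unique-range (suc n)) A-unique A⊆range
         separatedA Pw (All.map proj₁ optimal)
... | C , C-code , |C| , _ = ≤-trans (≤-reflexive (sym |C|)) (maximal C C-code)
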